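{- Let $D'$ be the planar network described below, with sources $u_n$ and sinks $v_k$, and for $n,k\ge 0$ let $T(n,k)=\sum_{\mathcal{P}\in\mathsf{P}_{n,k}} w(\mathcal{P})\in\mathbb{Z}[\mathcal{A},\mathcal{E}]$. Then the matrix $\mathbf{T}=(T(n,k))_{n,k\ge0}$ is coefficientwise totally positive (every minor is a polynomial in the indeterminates $\mathcal{A}\cup\mathcal{E}$ with nonnegative coefficients).
   Context: Let $\Delta(n)=\binom{n+1}{2}$ for $n\ge0$ (triangular numbers); for a triangular number $t$, $\Delta^{ -1}(t)$ is the unique $n\ge0$ with $\Delta(n)=t$. For an integer $m\ge0$, let $\lceil m\rceil_\Delta$ be the smallest triangular number $\ge m$ and $\delta(m)=\lceil m\rceil_\Delta-m$. Let $\mathcal{A}=\{a_{i,j,l}:(i,j,l)\in\mathbb{N}^3,\ j\le i\}$ and $\mathcal{E}=\{e_{i,l}:(i,l)\in\mathbb{N}^2\}$ be sets of commuting indeterminates ($\mathbb{N}=\{0,1,2,\dots\}$). Consider the digraph with vertex set $\{(i,j)\in\mathbb{Z}^2:0\le i\le j\}$ where, for $1\le i\le j$, there is a horizontal edge $(i,j)\to(i-1,j)$ of weight $\alpha_{i,j-i+1}$ and a diagonal edge $(i,j)\to(i-1,j-1)$ of weight $\beta_{i,j-i}$. Here, for $i\ge1,l\ge0$: $\beta_{i,l}=e_{\Delta^{ -1}(i+l-1)-l,\,l}$ if $i+l-1$ is triangular and $i+l-1\ge\Delta(l)$; $\beta_{i,l}=1$ if $i+l-1$ is not triangular and $i+l-1\ge\Delta(l)$;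 $\beta_{i,l}=0$ otherwise. For $i,l\ge1$: $\alpha_{i,l}=a_{\Delta^{ -1}(\lceil i+l-1\rceil_\Delta)-l,\ \delta(i+l-1),\ l-1}$ if $\Delta^{ -1}(\lceil i+l-1\rceil_\Delta)-l\ge\delta(i+l-1)$; otherwise $\alpha_{i,l}=1$ if $i+l-1$ is triangular and $i+l-1<\Delta(l)$; and $\alpha_{i,l}=0$ in all other cases. Deleting all edges of weight $0$ gives the digraph $D'$. Sources are $u_n=(\Delta(n),\Delta(n))$ and sinks $v_k=(0,\Delta(k))$ for $n,k\ge0$. The weight $w(\mathcal{P})$ of a directed path is the product of its edge weights, and $\mathsf{P}_{n,k}$ is the set of directed paths in $D'$ from $u_n$ to $v_k$. -}

module Defs where

open import Data.Nat as ℕ using (ℕ; zero; suc; _+_; _*_; _∸_; _≤ᵇ_; _≡ᵇ_; _<ᵇ_)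
open import Data.Integer as ℤ using (ℤ; +_; -_)
open import Data.Bool using (Bool; true; false; if_then_else_; _∧_; not)
open import Data.List as List using (List; []; _∷_; _++_; map; concatMap; foldr)
open import Data.Product using (_×_; _,_; proj₁; proj₂)
open import Data.Maybe using (Maybe; just; nothing)
open import Data.Fin as Fin using (Fin; toℕ; punchIn)
open import Data.List using (allFin)

Δ : ℕ → ℕ
Δ zero    = 0
Δ (suc n) = suc n + Δ n

-- ceilIdx m = least n with Δ(n) ≥ m  (so ⌈m⌉_Δ = Δ (ceilIdx m)).
-- Search n = 0,1,...,m (Δ(m) ≥ m, so m+1 steps suffice).
private
  search : ℕ → ℕ → ℕ → ℕ
  search m n zero       = n
  search m n (suc fuel) = if m ≤ᵇ Δ n then n else search m (suc n) fuel

ceilIdx : ℕ → ℕ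
ceilIdx m = search m 0 (suc m)

ceilΔ : ℕ → ℕ
ceilΔ m = Δ (ceilIdx m)

δ : ℕ → ℕ
δ m = ceilΔ m ∸ m

isTri : ℕ → Bool
isTri m = ceilΔ m ≡ᵇ m

-- Δ⁻¹(t) for triangular t (equals ceilIdx t in that case)
Δinv : ℕ → ℕ
Δinv = ceilIdx

-- Indeterminates  a_{i,j,l} (j ≤ i)  and  e_{i,l}

data Var : Set where
  a : ℕ → ℕ → ℕ → Var
  e : ℕ → ℕ → Var

_==V_ : Var → Var → Bool
a i j l ==V a i' j' l' = (i ≡ᵇ i') ∧ (j ≡ᵇ j') ∧ (l ≡ᵇ l')
e i l   ==V e i' l'    = (i ≡ᵇ i') ∧ (l ≡ᵇ l')
_       ==V _          = false

-- Polynomials in ℤ[𝒜, ℰ]: finite formal sums of terms c · m, where a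
-- monomial m is a finite multiset of variables (represented by a list).

Mon : Set
Mon = List Var

Poly : Set
Poly = List (ℤ × Mon)

countV : Var → Mon → ℕ
countV v []      = 0
countV v (w ∷ m) = (if v ==V w then 1 else 0) + countV v m

sameMon : Mon → Mon → Bool
sameMon m m' = foldr (λ v b → (countV v m ≡ᵇ countV v m') ∧ b) true (m ++ m')

coeff : Poly → Mon → ℤ
coeff []            m = + 0
coeff ((c , m') ∷ p) m = (if sameMon m' m then c else + 0) ℤ.+ coeff p m

0P : Poly
0P = []

1P : Poly
1P = (+ 1 , []) ∷ []

varP : Var → Poly
varP v = (+ 1 , v ∷ []) ∷ []

_+P_ : Poly → Poly → Poly
p +P q = p ++ q

_*P_ : Poly → Poly → Poly
p *P q = concatMap (λ { (c , m) → map (λ { (d , m') → (c ℤ.* d , m ++ m') }) q }) p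

negP : Poly → Poly
negP = map (λ { (c , m) → (- c , m) })

sumP : List Poly → Poly
sumP = foldr _+P_ 0P

NonNeg : Poly → Set
NonNeg p = (m : Mon) → + 0 ℤ.≤ coeff p m

data Weight : Set where
  wzero : Weight
  wone  : Weight
  wvar  : Var → Weight

toPoly : Weight → Poly
toPoly wzero    = 0P
toPoly wone     = 1P
toPoly (wvar v) = varP v

β : ℕ → ℕ → Weight
β i l with Δ l ≤ᵇ (i + l ∸ 1)
... | false = wzero
... | true  = if isTri (i + l ∸ 1)
                then wvar (e (Δinv (i + l ∸ 1) ∸ l) l)
                else wone

-- α_{i,l}, for i, l ≥ 1   (s = i + l − 1, N = Δ⁻¹(⌈s⌉_Δ) = ceilIdx s)
α : ℕ → ℕ → Weight
α i l =
  let s = i + l ∸ 1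
      N = ceilIdx s
  in if (l ≤ᵇ N) ∧ (δ s ≤ᵇ N ∸ l)
       then wvar (a (N ∸ l) (δ s) (l ∸ 1))
       else (if isTri s ∧ (s <ᵇ Δ l) then wone else wzero)

-- From (i, j) (1 ≤ i ≤ j):  H = horizontal edge (i,j) → (i−1,j), weight α_{i,j−i+1};
--                            D = diagonal edge  (i,j) → (i−1,j−1), weight β_{i,j−i}.
data Step : Set where
  H D : Step

seqs : ℕ → List (List Step)
seqs zero    = [] ∷ []
seqs (suc n) = map (H ∷_) (seqs n) ++ map (D ∷_) (seqs n)

edgeW : Step → ℕ → ℕ → Weight
edgeW H i j = α i (suc (j ∸ i))
edgeW D i j = β i (j ∸ i)

target : Step → ℕ → ℕ
target H j = j
target D j = j ∸ 1

-- Returns the final column and the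
-- path weight, or nothing if the sequence does not describe a path in D'
-- (uses an edge of weight 0, i.e. a deleted edge, or the wrong length).
run : ℕ → ℕ → List Step → Maybe (ℕ × Poly)
run zero    j []       = just (j , 1P)
run zero    j (_ ∷ _)  = nothing
run (suc i) j []       = nothing
run (suc i) j (s ∷ ss) with edgeW s (suc i) j
... | wzero = nothing
... | w     with run i (target s j) ss
...   | nothing       = nothing
...   | just (j' , p) = just (j' , toPoly w *P p)

contrib : ℕ → ℕ → List Step → Poly
contrib n k ss with run (Δ n) (Δ n) ss
... | nothing      = 0P
... | just (j , p) = if j ≡ᵇ Δ k then p else 0P

T : ℕ → ℕ → Poly
T n k = sumP (map (contrib n k) (seqs (Δ n)))

signP : ℕ → Poly → Poly
signP zero          p = p
signP (suc zero)    p = negP p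
signP (suc (suc n)) p = signP n p

det : (m : ℕ) → (Fin m → Fin m → Poly) → Poly
det zero    M = 1P
det (suc m) M =
  sumP (map (λ j → signP (toℕ j) (M Fin.zero j *P det m (λ r c → M (Fin.suc r) (punchIn j c))))
            (allFin (suc m)))

StrictlyIncreasing : {m : ℕ} → (Fin m → ℕ) → Set
StrictlyIncreasing {m} f = (x y : Fin m) → x Fin.< y → f x ℕ.< f y

CoeffTP : (ℕ → ℕ → Poly) → Set
CoeffTP A = (m : ℕ) (r c : Fin m → ℕ) → StrictlyIncreasing r → StrictlyIncreasing c →
            NonNeg (det m (λ x y → A (r x) (c y)))

-- Every edge of the network lowers the first coordinate by one, so summing over paths layer by
-- layer writes T, on rows Δ n and columns Δ k, as a product of upper bidiagonal matrices whose
-- entries are 0, 1 or single indeterminates; layer i is padded with the identity on the columns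
-- k ≤ i, so that paths from all the sources (Δ n, Δ n) are counted by the same product. The
-- Kronecker kernel is totally positive, and total positivity survives right multiplication by such
-- a bidiagonal matrix: each column of a minor of the product is a nonnegative combination of two
-- adjacent columns of the old kernel, and expanding by linearity in the columns leaves minors of
-- the old kernel and minors with a repeated column, which vanish.

module Submission where

open import Defs

open import Algebra.Bundles using (CommutativeRing)
import Algebra.Properties.CommutativeSemigroup as CommutativeSemigroupProperties
open import Algebra.Structures using (IsCommutativeRing)
open import Data.Bool using (Bool; true; false; if_then_else_; _∧_) renaming (T to Tᵇ)
open import Data.Bool.Properties using (T-∧)
open import Data.Empty using (⊥-elim)
open import Data.Fin as Fin using (Fin; zero; suc; toℕ; punchIn; punchOut; fromℕ<)
import Data.Fin.Properties as FinP
open import Data.Integer as ℤ using (ℤ; +_; -_; +≤+)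
import Data.Integer.Properties as ℤP
open import Data.List using (List; []; _∷_; _++_; map; foldr; tabulate)
import Data.List.Properties as List
open import Data.List.Membership.Propositional using (_∈_)
open import Data.List.Relation.Unary.All as All using (All; []; _∷_)
import Data.List.Relation.Unary.All.Properties as All
open import Data.List.Relation.Unary.Any using (here; there)
open import Data.Maybe as Maybe using (Maybe; just; nothing; _>>=_)
open import Data.Nat as ℕ using (ℕ; zero; suc; z≤n; s≤s; _∸_; pred; _≡ᵇ_; _≤ᵇ_; _<ᵇ_)
import Data.Nat.Properties as ℕP
open import Data.Product using (_×_; _,_; ∃-syntax)
open import Data.Sum using (_⊎_; inj₁; inj₂)
open import Data.Vec.Functional using (updateAt)
open import Data.Vec.Functional.Properties using (updateAt-updates; updateAt-minimal)
open import Function using (id; _∘_; case_of_; Equivalence)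
open import Level using (0ℓ)
open import Relation.Binary.PropositionalEquality
open import Relation.Nullary using (¬_; yes; no; does; _×-dec_)
open import Relation.Nullary.Decidable using (dec-true; dec-false)
open import Tactic.RingSolver.Core.AlmostCommutativeRing using (fromCommutativeRing)
import Tactic.RingSolver.NonReflective as RingSolver

private variable
  X Y : Set
  n : ℕ

T-injective : ∀ {b c} → (Tᵇ b → Tᵇ c) → (Tᵇ c → Tᵇ b) → b ≡ c
T-injective {false} {false} _ _ = refl
T-injective {false} {true}  _ g with () ← g _
T-injective {true}  {false} f _ with () ← f _
T-injective {true}  {true}  _ _ = refl

==V-refl : ∀ v → Tᵇ (v ==V v)
==V-refl (a i j l) =
  Equivalence.from T-∧ (ℕP.≡⇒≡ᵇ i i refl , Equivalence.from T-∧ (ℕP.≡⇒≡ᵇ j j refl , ℕP.≡⇒≡ᵇ l l refl))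
==V-refl (e i l)   = Equivalence.from T-∧ (ℕP.≡⇒≡ᵇ i i refl , ℕP.≡⇒≡ᵇ l l refl)

==V-sound : ∀ v w → Tᵇ (v ==V w) → v ≡ w
==V-sound (a i j l) (a i′ j′ l′) h
  with i≡ , h′ ← Equivalence.to T-∧ h
  with j≡ , l≡ ← Equivalence.to T-∧ h′ =
  cong₂ (λ (x , y) z → a x y z) (cong₂ _,_ (ℕP.≡ᵇ⇒≡ i i′ i≡) (ℕP.≡ᵇ⇒≡ j j′ j≡))
                                (ℕP.≡ᵇ⇒≡ l l′ l≡)
==V-sound (e i l) (e i′ l′) h
  with i≡ , l≡ ← Equivalence.to T-∧ h =
  cong₂ e (ℕP.≡ᵇ⇒≡ i i′ i≡) (ℕP.≡ᵇ⇒≡ l l′ l≡)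

infix 4 _∼_
_∼_ : Mon → Mon → Set
x ∼ y = ∀ v → countV v x ≡ countV v y

countV-++ : ∀ v x y → countV v (x ++ y) ≡ countV v x ℕ.+ countV v y
countV-++ v []      y = refl
countV-++ v (w ∷ x) y = trans (cong (c ℕ.+_) (countV-++ v x y)) (sym (ℕP.+-assoc c (countV v x) _))
  where c = if v ==V w then 1 else 0

++-comm-∼ : ∀ x y → x ++ y ∼ y ++ x
++-comm-∼ x y v = trans (countV-++ v x y) (trans (ℕP.+-comm (countV v x) _) (sym (countV-++ v y x)))

countV≡0⊎∈ : ∀ v x → countV v x ≡ 0 ⊎ v ∈ x
countV≡0⊎∈ v []      = inj₁ refl
countV≡0⊎∈ v (w ∷ x) with v ==V w in eq
... | true  = inj₂ (here (==V-sound v w (subst Tᵇ (sym eq) _)))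
... | false with countV≡0⊎∈ v x
...   | inj₁ z   = inj₁ z
...   | inj₂ v∈x = inj₂ (there v∈x)

T-foldr-∧⁻ : ∀ (f : Var → Bool) l → Tᵇ (foldr (λ v b → f v ∧ b) true l) → All (Tᵇ ∘ f) l
T-foldr-∧⁻ f []      _ = []
T-foldr-∧⁻ f (v ∷ l) h with hv , hl ← Equivalence.to T-∧ h = hv ∷ T-foldr-∧⁻ f l hl

T-foldr-∧⁺ : ∀ (f : Var → Bool) l → All (Tᵇ ∘ f) l → Tᵇ (foldr (λ v b → f v ∧ b) true l)
T-foldr-∧⁺ f []      []         = _
T-foldr-∧⁺ f (v ∷ l) (hv ∷ hl) = Equivalence.from T-∧ (hv , T-foldr-∧⁺ f l hl)

sameMon-sound : ∀ x y → Tᵇ (sameMon x y) → x ∼ y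
sameMon-sound x y h v with agree ← T-foldr-∧⁻ _ (x ++ y) h | countV≡0⊎∈ v x | countV≡0⊎∈ v y
... | inj₂ v∈x | _        = ℕP.≡ᵇ⇒≡ _ _ (All.lookup (All.++⁻ˡ x agree) v∈x)
... | inj₁ _   | inj₂ v∈y = ℕP.≡ᵇ⇒≡ _ _ (All.lookup (All.++⁻ʳ x agree) v∈y)
... | inj₁ x₀  | inj₁ y₀  = trans x₀ (sym y₀)

sameMon-complete : ∀ x y → x ∼ y → Tᵇ (sameMon x y)
sameMon-complete x y x∼y = T-foldr-∧⁺ _ (x ++ y) (All.universal (λ v → ℕP.≡⇒≡ᵇ _ _ (x∼y v)) (x ++ y))

sameMon-resp : ∀ {x x′ y y′} → x ∼ x′ → y ∼ y′ → sameMon x y ≡ sameMon x′ y′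
sameMon-resp {x} {x′} {y} {y′} x∼x′ y∼y′ = T-injective
  (λ h → sameMon-complete x′ y′ λ v → trans (sym (x∼x′ v)) (trans (sameMon-sound x y h v) (y∼y′ v)))
  (λ h → sameMon-complete x y λ v → trans (x∼x′ v) (trans (sameMon-sound x′ y′ h v) (sym (y∼y′ v))))

removeV : Var → Mon → Maybe Mon
removeV v []      = nothing
removeV v (w ∷ m) = if v ==V w then just m else Maybe.map (w ∷_) (removeV v m)

removeV-just : ∀ v m {m′} → removeV v m ≡ just m′ → m ∼ v ∷ m′
removeV-just v (w ∷ m) h u with v ==V w in eq
... | true with refl ← h | refl ← ==V-sound v w (subst Tᵇ (sym eq) _) = refl
... | false with removeV v m in eq′
...   | just m″ with refl ← h =
  trans (cong ([u=w] ℕ.+_) (removeV-just v m eq′ u)) (x∙yz≈y∙xz [u=w] [u=v] (countV u m″))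
  where
  open CommutativeSemigroupProperties ℕP.+-commutativeSemigroup using (x∙yz≈y∙xz)
  [u=w] = if u ==V w then 1 else 0
  [u=v] = if u ==V v then 1 else 0

removeV-nothing : ∀ v m → removeV v m ≡ nothing → countV v m ≡ 0
removeV-nothing v []      _ = refl
removeV-nothing v (w ∷ m) h with v ==V w in eq
... | false with removeV v m in eq′
...   | nothing = removeV-nothing v m eq′

matches : Mon → Maybe Mon → Bool
matches y nothing   = false
matches y (just m)  = sameMon y m

countV-self : ∀ v x → countV v (v ∷ x) ≡ suc (countV v x)
countV-self v x with v ==V v | ==V-refl v
... | true | _ = refl

sameMon-∷ : ∀ v x m → sameMon (v ∷ x) m ≡ matches x (removeV v m)
sameMon-∷ v x m with removeV v m in eq
... | just m′ = T-injective
  (λ h → sameMon-complete x m′ λ u → ℕP.+-cancelˡ-≡ _ _ _ (trans (sameMon-sound (v ∷ x) m h u) (removeV-just v m eq u)))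
  (λ h → sameMon-complete (v ∷ x) m λ u → trans (cong (_ ℕ.+_) (sameMon-sound x m′ h u)) (sym (removeV-just v m eq u)))
... | nothing = T-injective (λ h → ℕP.1+n≢0 (count-v h)) λ ()
  where
  count-v : Tᵇ (sameMon (v ∷ x) m) → suc (countV v x) ≡ 0
  count-v h = trans (sym (countV-self v x)) (trans (sameMon-sound (v ∷ x) m h v) (removeV-nothing v m eq))

removeMon : Mon → Mon → Maybe Mon
removeMon []      m = just m
removeMon (v ∷ x) m = removeV v m >>= removeMon x

sameMon-++ : ∀ x y m → sameMon (x ++ y) m ≡ matches y (removeMon x m)
sameMon-++ []      y m = refl
sameMon-++ (v ∷ x) y m rewrite sameMon-∷ v (x ++ y) m with removeV v m
... | nothing = refl
... | just m′ = sameMon-++ x y m′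

ΣL : List X → (X → ℤ) → ℤ
ΣL []      f = + 0
ΣL (t ∷ l) f = f t ℤ.+ ΣL l f

ΣL-cong : ∀ (l : List X) {f g : X → ℤ} → (∀ t → f t ≡ g t) → ΣL l f ≡ ΣL l g
ΣL-cong []      f≗g = refl
ΣL-cong (t ∷ l) f≗g = cong₂ ℤ._+_ (f≗g t) (ΣL-cong l f≗g)

ΣL-zero : ∀ (l : List X) → ΣL l (λ _ → + 0) ≡ + 0
ΣL-zero []      = refl
ΣL-zero (t ∷ l) = trans (ℤP.+-identityˡ _) (ΣL-zero l)

ΣL-++ : ∀ (l l′ : List X) f → ΣL (l ++ l′) f ≡ ΣL l f ℤ.+ ΣL l′ f
ΣL-++ []      l′ f = sym (ℤP.+-identityˡ _)
ΣL-++ (t ∷ l) l′ f = trans (cong (ℤ._+_ (f t)) (ΣL-++ l l′ f)) (sym (ℤP.+-assoc (f t) _ _))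

ΣL-+ : ∀ (l : List X) f g → ΣL l (λ t → f t ℤ.+ g t) ≡ ΣL l f ℤ.+ ΣL l g
ΣL-+ []      f g = refl
ΣL-+ (t ∷ l) f g = trans (cong (ℤ._+_ (f t ℤ.+ g t)) (ΣL-+ l f g)) (interchange (f t) (g t) _ _)
  where open CommutativeSemigroupProperties ℤP.+-commutativeSemigroup using (interchange)

ΣL-*ˡ : ∀ (l : List X) c f → ΣL l (λ t → c ℤ.* f t) ≡ c ℤ.* ΣL l f
ΣL-*ˡ []      c f = sym (ℤP.*-zeroʳ c)
ΣL-*ˡ (t ∷ l) c f = trans (cong (ℤ._+_ (c ℤ.* f t)) (ΣL-*ˡ l c f)) (sym (ℤP.*-distribˡ-+ c (f t) _))

ΣL-map : (l : List X) (g : X → Y) (f : Y → ℤ) → ΣL (map g l) f ≡ ΣL l (f ∘ g)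
ΣL-map []      g f = refl
ΣL-map (t ∷ l) g f = cong (ℤ._+_ (f (g t))) (ΣL-map l g f)

ΣL-swap : (l : List X) (l′ : List Y) (f : X → Y → ℤ) →
          ΣL l (λ s → ΣL l′ (f s)) ≡ ΣL l′ (λ t → ΣL l (λ s → f s t))
ΣL-swap []      l′ f = sym (ΣL-zero l′)
ΣL-swap (s ∷ l) l′ f = trans (cong (ℤ._+_ (ΣL l′ (f s))) (ΣL-swap l l′ f))
                             (sym (ΣL-+ l′ (f s) (λ t → ΣL l (λ s → f s t))))

termCoeff : Mon → ℤ × Mon → ℤ
termCoeff m (c , x) = if sameMon x m then c else + 0

coeff-ΣL : ∀ p m → coeff p m ≡ ΣL p (termCoeff m)
coeff-ΣL []      m = refl
coeff-ΣL (t ∷ p) m = cong (ℤ._+_ (termCoeff m t)) (coeff-ΣL p m)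

ΣL-*P : ∀ p q f → ΣL (p *P q) f ≡ ΣL p (λ (c , x) → ΣL q (λ (d , y) → f (c ℤ.* d , x ++ y)))
ΣL-*P []            q f = refl
ΣL-*P ((c , x) ∷ p) q f = trans (ΣL-++ (map _ q) (p *P q) f)
                                (cong₂ ℤ._+_ (ΣL-map q _ f) (ΣL-*P p q f))

coeff-*P : ∀ p q m → coeff (p *P q) m ≡
           ΣL p (λ (c , x) → ΣL q (λ (d , y) → termCoeff m (c ℤ.* d , x ++ y)))
coeff-*P p q m = trans (coeff-ΣL (p *P q) m) (ΣL-*P p q (termCoeff m))

if-*ˡ : ∀ (b : Bool) c d → (if b then c ℤ.* d else + 0) ≡ c ℤ.* (if b then d else + 0)
if-*ˡ true  c d = refl
if-*ˡ false c d = sym (ℤP.*-zeroʳ c)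

coeffIn : Poly → Maybe Mon → ℤ
coeffIn q M = ΣL q (λ (d , y) → if matches y M then d else + 0)

-- The contribution of a term c·x of p to coeff-*P depends on q only through its coefficients.
ΣL-shift : ∀ c x q m → ΣL q (λ (d , y) → termCoeff m (c ℤ.* d , x ++ y)) ≡ c ℤ.* coeffIn q (removeMon x m)
ΣL-shift c x q m = trans (ΣL-cong q λ (d , y) → trans (cong (λ b → if b then c ℤ.* d else + 0) (sameMon-++ x y m))
                                                        (if-*ˡ (matches y (removeMon x m)) c d))
                         (ΣL-*ˡ q c _)

-- The polynomial ring

infix 4 _≈_
record _≈_ (p q : Poly) : Set where
  constructor mk≈
  field at : ∀ m → coeff p m ≡ coeff q m
open _≈_ public

≈-refl : ∀ {p} → p ≈ p
≈-refl = mk≈ λ _ → refl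

≈-sym : ∀ {p q} → p ≈ q → q ≈ p
≈-sym p≈q = mk≈ λ m → sym (at p≈q m)

≈-trans : ∀ {p q r} → p ≈ q → q ≈ r → p ≈ r
≈-trans p≈q q≈r = mk≈ λ m → trans (at p≈q m) (at q≈r m)

coeff-+P : ∀ p q m → coeff (p +P q) m ≡ coeff p m ℤ.+ coeff q m
coeff-+P p q m = trans (coeff-ΣL (p ++ q) m)
                       (trans (ΣL-++ p q (termCoeff m)) (sym (cong₂ ℤ._+_ (coeff-ΣL p m) (coeff-ΣL q m))))

coeff-negP : ∀ p m → coeff (negP p) m ≡ - coeff p m
coeff-negP []            m = refl
coeff-negP ((c , x) ∷ p) m =
  trans (cong₂ ℤ._+_ (if-neg (sameMon x m)) (coeff-negP p m)) (sym (ℤP.neg-distrib-+ (termCoeff m (c , x)) (coeff p m)))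
  where
  if-neg : ∀ b → (if b then - c else + 0) ≡ - (if b then c else + 0)
  if-neg true  = refl
  if-neg false = refl

coeffIn-resp : ∀ {q q′} → q ≈ q′ → ∀ M → coeffIn q M ≡ coeffIn q′ M
coeffIn-resp {q} {q′} q≈q′ nothing  = trans (ΣL-zero q) (sym (ΣL-zero q′))
coeffIn-resp {q} {q′} q≈q′ (just m) = trans (sym (coeff-ΣL q m)) (trans (at q≈q′ m) (coeff-ΣL q′ m))

+P-cong : ∀ {p p′ q q′} → p ≈ p′ → q ≈ q′ → p +P q ≈ p′ +P q′
+P-cong {p} {p′} {q} {q′} p≈p′ q≈q′ = mk≈ λ m →
  trans (coeff-+P p q m) (trans (cong₂ ℤ._+_ (at p≈p′ m) (at q≈q′ m)) (sym (coeff-+P p′ q′ m)))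

+P-comm : ∀ p q → p +P q ≈ q +P p
+P-comm p q = mk≈ λ m → trans (coeff-+P p q m) (trans (ℤP.+-comm (coeff p m) _) (sym (coeff-+P q p m)))

negP-cong : ∀ {p q} → p ≈ q → negP p ≈ negP q
negP-cong {p} {q} p≈q = mk≈ λ m → trans (coeff-negP p m) (trans (cong -_ (at p≈q m)) (sym (coeff-negP q m)))

negP-inverseˡ : ∀ p → negP p +P p ≈ 0P
negP-inverseˡ p = mk≈ λ m → trans (coeff-+P (negP p) p m)
                                  (trans (cong (ℤ._+ coeff p m) (coeff-negP p m)) (ℤP.+-inverseˡ (coeff p m)))

*P-comm : ∀ p q → p *P q ≈ q *P p
*P-comm p q = mk≈ λ m → trans (coeff-*P p q m) (trans (ΣL-swap p q _) (trans
  (ΣL-cong q λ (d , y) → ΣL-cong p λ (c , x) →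
     cong₂ (λ b z → if b then z else + 0) (sameMon-resp {x ++ y} {y ++ x} {m} {m} (++-comm-∼ x y) λ _ → refl) (ℤP.*-comm c d))
  (sym (coeff-*P q p m))))

*P-assoc : ∀ p q r → (p *P q) *P r ≈ p *P (q *P r)
*P-assoc p q r = mk≈ λ m → trans (coeff-*P (p *P q) r m) (trans (ΣL-*P p q _) (trans
  (ΣL-cong p λ (c , x) → trans (ΣL-cong q λ (d , y) → ΣL-cong r λ (f , z) →
                                  cong₂ (λ w k → termCoeff m (k , w)) (List.++-assoc x y z) (ℤP.*-assoc c d f))
                               (sym (ΣL-*P q r _)))
  (sym (coeff-*P p (q *P r) m))))

*P-congʳ : ∀ p {q q′} → q ≈ q′ → p *P q ≈ p *P q′
*P-congʳ p {q} {q′} q≈q′ = mk≈ λ m → trans (coeff-*P p q m) (trans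
  (ΣL-cong p λ (c , x) → trans (ΣL-shift c x q m) (trans (cong (c ℤ.*_) (coeffIn-resp q≈q′ (removeMon x m)))
                                                     (sym (ΣL-shift c x q′ m))))
  (sym (coeff-*P p q′ m)))

*P-cong : ∀ {p p′ q q′} → p ≈ p′ → q ≈ q′ → p *P q ≈ p′ *P q′
*P-cong {p} {p′} {q} {q′} p≈p′ q≈q′ =
  ≈-trans (*P-congʳ p q≈q′) (≈-trans (*P-comm p q′) (≈-trans (*P-congʳ q′ p≈p′) (*P-comm q′ p′)))

*P-identityˡ : ∀ p → 1P *P p ≈ p
*P-identityˡ p = mk≈ λ m → trans (coeff-*P 1P p m) (trans (ℤP.+-identityʳ _) (trans
  (ΣL-cong p λ (d , y) → cong (λ k → termCoeff m (k , y)) (ℤP.*-identityˡ d))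
  (sym (coeff-ΣL p m))))

*P-distribˡ : ∀ p q r → p *P (q +P r) ≈ (p *P q) +P (p *P r)
*P-distribˡ p q r = mk≈ λ m → trans (coeff-*P p (q ++ r) m) (trans
  (ΣL-cong p λ (c , x) → ΣL-++ q r _) (trans (ΣL-+ p _ _) (trans
  (sym (cong₂ ℤ._+_ (coeff-*P p q m) (coeff-*P p r m)))
  (sym (coeff-+P (p *P q) (p *P r) m)))))

isCommutativeRing : IsCommutativeRing _≈_ _+P_ _*P_ negP 0P 1P
isCommutativeRing = record
  { isRing = record
    { +-isAbelianGroup = record
      { isGroup = record
        { isMonoid = record
          { isSemigroup = record
            { isMagma = record
              { isEquivalence = record { refl = ≈-refl ; sym = ≈-sym ; trans = ≈-trans }
              ; ∙-cong = +P-cong }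
            ; assoc = λ p q r → ≡⇒≈ (List.++-assoc p q r) }
          ; identity = (λ _ → ≈-refl) , (λ p → ≡⇒≈ (List.++-identityʳ p)) }
        ; inverse = negP-inverseˡ , λ p → ≈-trans (+P-comm p (negP p)) (negP-inverseˡ p)
        ; ⁻¹-cong = negP-cong }
      ; comm = +P-comm }
    ; *-cong = *P-cong
    ; *-assoc = *P-assoc
    ; *-identity = *P-identityˡ , (λ p → ≈-trans (*P-comm p 1P) (*P-identityˡ p))
    ; distrib = *P-distribˡ , λ p q r → ≈-trans (*P-comm (q +P r) p)
                                          (≈-trans (*P-distribˡ p q r) (+P-cong (*P-comm p q) (*P-comm p r))) }
  ; *-comm = *P-comm }
  where
  ≡⇒≈ : ∀ {p q} → p ≡ q → p ≈ q
  ≡⇒≈ refl = ≈-refl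

PolyRing : CommutativeRing 0ℓ 0ℓ
PolyRing = record { isCommutativeRing = isCommutativeRing }

module R = CommutativeRing PolyRing
open R using (_+_; _*_)
open import Algebra.Properties.Ring R.ring using (-‿distribˡ-*; -‿involutive)
open import Algebra.Properties.Semiring.Sum R.semiring using (sum; ∑-distrib-+; *-distribˡ-sum; sum-cong-≋; sum-replicate-zero)
open import Relation.Binary.Reasoning.Setoid R.setoid

noZeroTest : ∀ p → Maybe (0P ≈ p)
noZeroTest _ = nothing

open RingSolver (fromCommutativeRing PolyRing noZeroTest) using (solve; _⊜_; _⊕_; _⊗_)

-- Determinants

Matrix : ℕ → Set
Matrix n = Fin n → Fin n → Poly

sumP-tabulate : ∀ n (f : Fin n → Poly) → sumP (tabulate f) ≡ sum f
sumP-tabulate zero    f = refl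
sumP-tabulate (suc n) f = cong (f zero +P_) (sumP-tabulate n (f ∘ suc))

*-congˡ : ∀ x {y z} → y ≈ z → x * y ≈ x * z
*-congˡ x = R.*-congˡ {x}

*-congʳ : ∀ z {x y} → x ≈ y → x * z ≈ y * z
*-congʳ z = R.*-congʳ {z}

sum-cong : ∀ (f g : Fin n → Poly) → (∀ j → f j ≈ g j) → sum f ≈ sum g
sum-cong f g = sum-cong-≋ {x = f} {y = g}

sum-zero : ∀ n (f : Fin n → Poly) → (∀ j → f j ≈ 0P) → sum f ≈ 0P
sum-zero n f f≈0 = R.trans (sum-cong f (λ _ → 0P) f≈0) (sum-replicate-zero n)

sign : ℕ → Poly
sign k = signP k 1P

signP-sign : ∀ k p → signP k p ≈ sign k * p
signP-sign zero          p = R.sym (R.*-identityˡ p)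
signP-sign (suc zero)    p = R.trans (negP-cong (R.sym (R.*-identityˡ p))) (-‿distribˡ-* 1P p)
signP-sign (suc (suc k)) p = signP-sign k p

sign-suc : ∀ k → sign (suc k) ≈ negP (sign k)
sign-suc zero    = R.refl
sign-suc (suc k) = R.trans (R.sym (-‿involutive (sign k))) (negP-cong (R.sym (sign-suc k)))

minor : Fin (suc n) → Matrix (suc n) → Matrix n
minor j M r c = M (suc r) (punchIn j c)

laplaceTerm : ∀ n → Matrix (suc n) → Fin (suc n) → Poly
laplaceTerm n M j = sign (toℕ j) * (M zero j * det n (minor j M))

det-expand : ∀ n M → det (suc n) M ≈ sum (laplaceTerm n M)
det-expand n M = R.trans (R.reflexive (trans (cong sumP (List.map-tabulate id term)) (sumP-tabulate (suc n) term)))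
                         (sum-cong term (laplaceTerm n M) λ j → signP-sign (toℕ j) _)
  where
  term : Fin (suc n) → Poly
  term j = signP (toℕ j) (M zero j * det n (minor j M))

det-cong : ∀ n {M N : Matrix n} → (∀ x y → M x y ≈ N x y) → det n M ≈ det n N
det-cong zero    _   = R.refl
det-cong (suc n) {M} {N} M≈N = begin
  det (suc n) M          ≈⟨ det-expand n M ⟩
  sum (laplaceTerm n M)  ≈⟨ sum-cong (laplaceTerm n M) (laplaceTerm n N) same-terms ⟩
  sum (laplaceTerm n N)  ≈⟨ det-expand n N ⟨
  det (suc n) N          ∎
  where
  same-terms : ∀ j → laplaceTerm n M j ≈ laplaceTerm n N j
  same-terms j = *-congˡ (sign (toℕ j)) (R.*-cong (M≈N zero j) (det-cong n λ r c → M≈N (suc r) (punchIn j c)))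

record SplitsAt (y : Fin n) (p q : Poly) (M M₁ M₂ : Matrix n) : Set where
  field
    off₁ : ∀ x c → c ≢ y → M x c ≈ M₁ x c
    off₂ : ∀ x c → c ≢ y → M x c ≈ M₂ x c
    at-y : ∀ x → M x y ≈ p * M₁ x y + q * M₂ x y

minor-splitsAt : ∀ {y j : Fin (suc n)} {p q M M₁ M₂} (j≢y : j ≢ y) → SplitsAt y p q M M₁ M₂ →
                 SplitsAt (punchOut j≢y) p q (minor j M) (minor j M₁) (minor j M₂)
minor-splitsAt {y = y} {j} {p} {q} {M} {M₁} {M₂} j≢y split = record
  { off₁ = λ r c c≢y′ → off₁ (suc r) (punchIn j c) (avoids-y c≢y′)
  ; off₂ = λ r c c≢y′ → off₂ (suc r) (punchIn j c) (avoids-y c≢y′)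
  ; at-y = λ r → subst (λ c → M (suc r) c ≈ p * M₁ (suc r) c + q * M₂ (suc r) c)
                       (sym (FinP.punchIn-punchOut j≢y)) (at-y (suc r))
  }
  where
  open SplitsAt split
  avoids-y : ∀ {c} → c ≢ punchOut j≢y → punchIn j c ≢ y
  avoids-y c≢y′ eq = c≢y′ (FinP.punchIn-injective j _ _ (trans eq (sym (FinP.punchIn-punchOut j≢y))))

det-linear : ∀ n {y p q} {M M₁ M₂ : Matrix n} → SplitsAt y p q M M₁ M₂ → det n M ≈ p * det n M₁ + q * det n M₂

laplaceTerm-linear : ∀ n {y p q} {M M₁ M₂ : Matrix (suc n)} → SplitsAt y p q M M₁ M₂ →
                     ∀ j → laplaceTerm n M j ≈ p * laplaceTerm n M₁ j + q * laplaceTerm n M₂ j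
laplaceTerm-linear n {y} {p} {q} {M} {M₁} {M₂} split j with j Fin.≟ y
... | yes refl = begin
  s * (M zero j * Dⱼ)
    ≈⟨ *-congˡ s (*-congʳ Dⱼ (at-y zero)) ⟩
  s * ((p * M₁ zero j + q * M₂ zero j) * Dⱼ)
    ≈⟨ solve 6 (λ s p a q b d → s ⊗ ((p ⊗ a ⊕ q ⊗ b) ⊗ d) ⊜ (p ⊗ (s ⊗ (a ⊗ d)) ⊕ q ⊗ (s ⊗ (b ⊗ d))))
             R.refl s p (M₁ zero j) q (M₂ zero j) Dⱼ ⟩
  p * (s * (M₁ zero j * Dⱼ)) + q * (s * (M₂ zero j * Dⱼ))
    ≈⟨ R.+-cong (*-congˡ p (*-congˡ s (*-congˡ (M₁ zero j) (same-minor off₁))))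
                (*-congˡ q (*-congˡ s (*-congˡ (M₂ zero j) (same-minor off₂)))) ⟩
  p * laplaceTerm n M₁ j + q * laplaceTerm n M₂ j
    ∎
  where
  open SplitsAt split
  s = sign (toℕ j)
  Dⱼ = det n (minor j M)
  same-minor : ∀ {N} → (∀ x c → c ≢ j → M x c ≈ N x c) → Dⱼ ≈ det n (minor j N)
  same-minor M≈N = det-cong n λ r c → M≈N (suc r) (punchIn j c) (FinP.punchInᵢ≢i j c)
... | no j≢y = begin
  s * (M zero j * det n (minor j M))
    ≈⟨ *-congˡ s (*-congˡ (M zero j) (det-linear n (minor-splitsAt j≢y split))) ⟩
  s * (M zero j * (p * D₁ + q * D₂))
    ≈⟨ solve 6 (λ s a p d₁ q d₂ →
                  s ⊗ (a ⊗ (p ⊗ d₁ ⊕ q ⊗ d₂)) ⊜ (p ⊗ (s ⊗ (a ⊗ d₁)) ⊕ q ⊗ (s ⊗ (a ⊗ d₂))))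
             R.refl s (M zero j) p D₁ q D₂ ⟩
  p * (s * (M zero j * D₁)) + q * (s * (M zero j * D₂))
    ≈⟨ R.+-cong (*-congˡ p (*-congˡ s (*-congʳ D₁ (off₁ zero j j≢y))))
                (*-congˡ q (*-congˡ s (*-congʳ D₂ (off₂ zero j j≢y)))) ⟩
  p * laplaceTerm n M₁ j + q * laplaceTerm n M₂ j
    ∎
  where
  open SplitsAt split
  s = sign (toℕ j)
  D₁ = det n (minor j M₁)
  D₂ = det n (minor j M₂)

det-linear (suc n) {y} {p} {q} {M} {M₁} {M₂} split = begin
  det (suc n) M
    ≈⟨ det-expand n M ⟩
  sum (laplaceTerm n M)
    ≈⟨ sum-cong (laplaceTerm n M) _ (laplaceTerm-linear n split) ⟩
  sum (λ j → p * laplaceTerm n M₁ j + q * laplaceTerm n M₂ j)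
    ≈⟨ ∑-distrib-+ (λ j → p * laplaceTerm n M₁ j) (λ j → q * laplaceTerm n M₂ j) ⟩
  sum (λ j → p * laplaceTerm n M₁ j) + sum (λ j → q * laplaceTerm n M₂ j)
    ≈⟨ R.+-cong (*-distribˡ-sum p (laplaceTerm n M₁)) (*-distribˡ-sum q (laplaceTerm n M₂)) ⟨
  p * sum (laplaceTerm n M₁) + q * sum (laplaceTerm n M₂)
    ≈⟨ R.+-cong (*-congˡ p (det-expand n M₁)) (*-congˡ q (det-expand n M₂)) ⟨
  p * det (suc n) M₁ + q * det (suc n) M₂
    ∎

det-zero-column : ∀ n (M : Matrix n) y → (∀ x → M x y ≈ 0P) → det n M ≈ 0P
det-zero-column n M y M≈0 = begin
  det n M                      ≈⟨ det-linear n split ⟩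
  0P * det n M + 0P * det n M  ≈⟨ R.+-cong (R.zeroˡ (det n M)) (R.zeroˡ (det n M)) ⟩
  0P + 0P                      ≈⟨ R.+-identityˡ 0P ⟩
  0P                           ∎
  where
  split : SplitsAt y 0P 0P M M M
  split = record { off₁ = λ _ _ _ → R.refl ; off₂ = λ _ _ _ → R.refl ; at-y = M≈0 }

Adjacent : Fin n → Fin n → Set
Adjacent u w = toℕ w ≡ suc (toℕ u)

sum-pair-cancel : ∀ n (f : Fin n → Poly) {u w} → Adjacent u w →
                  (∀ j → j ≢ u → j ≢ w → f j ≈ 0P) → f u + f w ≈ 0P → sum f ≈ 0P
sum-pair-cancel (suc (suc n)) f {zero} {suc zero} _ others≈0 pair≈0 = begin
  f zero + (f (suc zero) + sum (λ j → f (suc (suc j))))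
    ≈⟨ R.+-assoc (f zero) _ _ ⟨
  (f zero + f (suc zero)) + sum (λ j → f (suc (suc j)))
    ≈⟨ R.+-cong pair≈0 (sum-zero n (λ j → f (suc (suc j))) λ j → others≈0 (suc (suc j)) (λ ()) (λ ())) ⟩
  0P + 0P
    ≈⟨ R.+-identityˡ 0P ⟩
  0P
    ∎
sum-pair-cancel (suc n) f {suc u} {suc w} adj others≈0 pair≈0 = begin
  f zero + sum (λ j → f (suc j))
    ≈⟨ R.+-cong (others≈0 zero (λ ()) (λ ()))
                (sum-pair-cancel n (λ j → f (suc j)) (ℕP.suc-injective adj) others≈0′ pair≈0) ⟩
  0P + 0P
    ≈⟨ R.+-identityˡ 0P ⟩
  0P
    ∎
  where
  others≈0′ : ∀ j → j ≢ u → j ≢ w → f (suc j) ≈ 0P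
  others≈0′ j j≢u j≢w = others≈0 (suc j) (j≢u ∘ FinP.suc-injective) (j≢w ∘ FinP.suc-injective)

punchIn-adjacent : ∀ {u w : Fin (suc n)} → Adjacent u w → ∀ c →
                   punchIn u c ≡ punchIn w c ⊎ (punchIn u c ≡ w × punchIn w c ≡ u)
punchIn-adjacent {_}     {zero}  {suc zero} _   zero    = inj₂ (refl , refl)
punchIn-adjacent {_}     {zero}  {suc zero} _   (suc c) = inj₁ refl
punchIn-adjacent {_}     {suc u} {suc w}    _   zero    = inj₁ refl
punchIn-adjacent {suc n} {suc u} {suc w}    adj (suc c) with punchIn-adjacent (ℕP.suc-injective adj) c
... | inj₁ same            = inj₁ (cong suc same)
... | inj₂ (to-w , to-u)   = inj₂ (cong suc to-w , cong suc to-u)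

punchOut-adjacent : ∀ {j u w : Fin (suc n)} (j≢u : j ≢ u) (j≢w : j ≢ w) →
                    Adjacent u w → Adjacent (punchOut j≢u) (punchOut j≢w)
punchOut-adjacent {_}           {zero}        {zero}  j≢u _ _ = ⊥-elim (j≢u refl)
punchOut-adjacent {_}           {zero}        {suc u} {suc w} _ _ adj = ℕP.suc-injective adj
punchOut-adjacent {suc n}       {suc zero}    {zero}  {suc zero} _ j≢w _ = ⊥-elim (j≢w refl)
punchOut-adjacent {suc (suc n)} {suc (suc j)} {zero}  {suc zero} _ _ _ = refl
punchOut-adjacent {suc n}       {suc j}       {suc u} {suc w} j≢u j≢w adj =
  cong suc (punchOut-adjacent (j≢u ∘ cong suc) (j≢w ∘ cong suc) (ℕP.suc-injective adj))

det-adjacent-equal : ∀ n (M : Matrix n) {u w} → Adjacent u w → (∀ x → M x u ≈ M x w) → det n M ≈ 0P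
det-adjacent-equal (suc n) M {u} {w} adj equal =
  R.trans (det-expand n M) (sum-pair-cancel (suc n) (laplaceTerm n M) adj others≈0 pair≈0)
  where
  others≈0 : ∀ j → j ≢ u → j ≢ w → laplaceTerm n M j ≈ 0P
  others≈0 j j≢u j≢w = begin
    sign (toℕ j) * (M zero j * det n (minor j M))  ≈⟨ *-congˡ (sign (toℕ j)) (*-congˡ (M zero j) minor≈0) ⟩
    sign (toℕ j) * (M zero j * 0P)                 ≈⟨ *-congˡ (sign (toℕ j)) (R.zeroʳ (M zero j)) ⟩
    sign (toℕ j) * 0P                              ≈⟨ R.zeroʳ (sign (toℕ j)) ⟩
    0P                                             ∎
    where
    minor≈0 : det n (minor j M) ≈ 0P
    minor≈0 = det-adjacent-equal n (minor j M) (punchOut-adjacent j≢u j≢w adj) λ r →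
      subst₂ (λ c c′ → M (suc r) c ≈ M (suc r) c′)
             (sym (FinP.punchIn-punchOut j≢u)) (sym (FinP.punchIn-punchOut j≢w)) (equal (suc r))
  same-minor : det n (minor u M) ≈ det n (minor w M)
  same-minor = det-cong n λ r c → case punchIn-adjacent adj c of λ where
    (inj₁ same)         → R.reflexive (cong (M (suc r)) same)
    (inj₂ (to-w , to-u)) → subst₂ (λ c c′ → M (suc r) c ≈ M (suc r) c′) (sym to-w) (sym to-u) (R.sym (equal (suc r)))
  s = sign (toℕ u)
  uTerm = M zero u * det n (minor u M)
  pair≈0 : laplaceTerm n M u + laplaceTerm n M w ≈ 0P
  pair≈0 = begin
    s * uTerm + sign (toℕ w) * (M zero w * det n (minor w M))
      ≈⟨ R.+-congˡ (R.*-cong (R.trans (R.reflexive (cong sign adj)) (sign-suc (toℕ u)))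
                             (R.*-cong (R.sym (equal zero)) (R.sym same-minor))) ⟩
    s * uTerm + negP s * uTerm   ≈⟨ R.+-congˡ (-‿distribˡ-* s uTerm) ⟨
    s * uTerm + negP (s * uTerm) ≈⟨ R.-‿inverseʳ (s * uTerm) ⟩
    0P                   ∎

Monotone : (Fin n → ℕ) → Set
Monotone τ = ∀ x y → x Fin.≤ y → τ x ℕ.≤ τ y

monotone-from-< : ∀ {τ : Fin n → ℕ} → (∀ x y → x Fin.< y → τ x ℕ.≤ τ y) → Monotone τ
monotone-from-< {τ = τ} mono-< x y x≤y with ℕP.m≤n⇒m<n∨m≡n x≤y
... | inj₁ x<y = mono-< x y x<y
... | inj₂ x≡y = ℕP.≤-reflexive (cong τ (FinP.toℕ-injective x≡y))

strictlyIncreasing⇒monotone : ∀ {f : Fin n → ℕ} → StrictlyIncreasing f → Monotone f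
strictlyIncreasing⇒monotone f↑ = monotone-from-< λ x y x<y → ℕP.<⇒≤ (f↑ x y x<y)

det-repeated-column : ∀ n (G : Fin n → ℕ → Poly) {τ} → Monotone τ →
                      ∀ {y₁ y₂} → y₁ Fin.< y₂ → τ y₁ ≡ τ y₂ →
                      det n (λ x y → G x (τ y)) ≈ 0P
det-repeated-column n G {τ} mono {y₁} {y₂} y₁<y₂ τy₁≡τy₂ =
  det-adjacent-equal n (λ x y → G x (τ y)) adj (λ x → R.reflexive (cong (G x) (sym τw≡τy₁)))
  where
  w = fromℕ< (ℕP.<-≤-trans (s≤s y₁<y₂) (FinP.toℕ<n y₂))
  adj : Adjacent y₁ w
  adj = FinP.toℕ-fromℕ< _
  τw≡τy₁ : τ w ≡ τ y₁
  τw≡τy₁ = ℕP.≤-antisym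
    (subst (τ w ℕ.≤_) (sym τy₁≡τy₂) (mono w y₂ (subst (ℕ._≤ toℕ y₂) (sym adj) y₁<y₂)))
    (mono y₁ w (subst (toℕ y₁ ℕ.≤_) (sym adj) (ℕP.n≤1+n _)))

NonNegTerms : Poly → Set
NonNegTerms = All (λ (c , _) → + 0 ℤ.≤ c)

-- Unlike NonNeg, having a representative with nonnegative terms is evidently closed under + and *.
NonNegRep : Poly → Set
NonNegRep p = ∃[ q ] (NonNegTerms q × q ≈ p)

private
  nonNeg-+ : ∀ {c d} → + 0 ℤ.≤ c → + 0 ℤ.≤ d → + 0 ℤ.≤ c ℤ.+ d
  nonNeg-+ (+≤+ _) (+≤+ _) = +≤+ z≤n

  nonNeg-* : ∀ {c d} → + 0 ℤ.≤ c → + 0 ℤ.≤ d → + 0 ℤ.≤ c ℤ.* d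
  nonNeg-* {+ m} {+ k} _ _ = subst (+ 0 ℤ.≤_) (ℤP.pos-* m k) (+≤+ z≤n)

nonNegTerms⇒nonNeg : ∀ {q} → NonNegTerms q → NonNeg q
nonNegTerms⇒nonNeg []                        m = +≤+ z≤n
nonNegTerms⇒nonNeg {(c , x) ∷ q} (0≤c ∷ 0≤q) m = nonNeg-+ term≥0 (nonNegTerms⇒nonNeg 0≤q m)
  where
  term≥0 : + 0 ℤ.≤ termCoeff m (c , x)
  term≥0 with sameMon x m
  ... | true  = 0≤c
  ... | false = +≤+ z≤n

nonNegRep⇒nonNeg : ∀ {p} → NonNegRep p → NonNeg p
nonNegRep⇒nonNeg (q , 0≤q , q≈p) m = subst (+ 0 ℤ.≤_) (at q≈p m) (nonNegTerms⇒nonNeg 0≤q m)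

nonNegRep-resp : ∀ {p p′} → p ≈ p′ → NonNegRep p → NonNegRep p′
nonNegRep-resp p≈p′ (q , 0≤q , q≈p) = q , 0≤q , R.trans q≈p p≈p′

nonNegRep-0P : NonNegRep 0P
nonNegRep-0P = [] , [] , R.refl

nonNegRep-≈0P : ∀ {p} → p ≈ 0P → NonNegRep p
nonNegRep-≈0P p≈0 = nonNegRep-resp (R.sym p≈0) nonNegRep-0P

nonNegRep-1P : NonNegRep 1P
nonNegRep-1P = 1P , +≤+ z≤n ∷ [] , R.refl

nonNegRep-toPoly : ∀ w → NonNegRep (toPoly w)
nonNegRep-toPoly wzero    = nonNegRep-0P
nonNegRep-toPoly wone     = nonNegRep-1P
nonNegRep-toPoly (wvar v) = varP v , +≤+ z≤n ∷ [] , R.refl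

nonNegRep-+ : ∀ {p p′} → NonNegRep p → NonNegRep p′ → NonNegRep (p + p′)
nonNegRep-+ (q , 0≤q , q≈p) (q′ , 0≤q′ , q′≈p′) = q + q′ , All.++⁺ 0≤q 0≤q′ , R.+-cong q≈p q′≈p′

nonNegRep-* : ∀ {p p′} → NonNegRep p → NonNegRep p′ → NonNegRep (p * p′)
nonNegRep-* (q , 0≤q , q≈p) (q′ , 0≤q′ , q′≈p′) =
  q * q′ , All.concat⁺ (All.map⁺ (All.map (λ 0≤c → All.map⁺ (All.map (nonNeg-* 0≤c) 0≤q′)) 0≤q))
         , R.*-cong q≈p q′≈p′

nonNegRep-sum : ∀ n (f : Fin n → Poly) → (∀ j → NonNegRep (f j)) → NonNegRep (sum f)
nonNegRep-sum zero    f _     = nonNegRep-0P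
nonNegRep-sum (suc n) f f≥0 = nonNegRep-+ (f≥0 zero) (nonNegRep-sum n (λ j → f (suc j)) (λ j → f≥0 (suc j)))

-- Totally positive kernels

TotallyPositive : (ℕ → ℕ → Poly) → Set
TotallyPositive G = ∀ n (ρ σ : Fin n → ℕ) → StrictlyIncreasing ρ → StrictlyIncreasing σ →
                    NonNegRep (det n (λ x y → G (ρ x) (σ y)))

kronecker : ℕ → ℕ → Poly
kronecker j k = if does (j ℕP.≟ k) then 1P else 0P

kronecker-≢ : ∀ {j k} → j ≢ k → kronecker j k ≡ 0P
kronecker-≢ {j} {k} j≢k = cong (if_then 1P else 0P) (dec-false (j ℕP.≟ k) j≢k)

nonNegRep-kronecker : ∀ j k → NonNegRep (kronecker j k)
nonNegRep-kronecker j k with j ℕ.≡ᵇ k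
... | true  = nonNegRep-1P
... | false = nonNegRep-0P

strictlyIncreasing-tail : ∀ {n} {ρ : Fin (suc n) → ℕ} → StrictlyIncreasing ρ → StrictlyIncreasing (ρ ∘ suc)
strictlyIncreasing-tail ρ↑ x y x<y = ρ↑ (suc x) (suc y) (s≤s x<y)

kronecker-TP : TotallyPositive kronecker
kronecker-TP zero    ρ σ _  _  = nonNegRep-1P
kronecker-TP (suc n) ρ σ ρ↑ σ↑ =
  nonNegRep-resp (R.sym (det-expand n M)) (nonNegRep-sum (suc n) (laplaceTerm n M) term≥0)
  where
  M : Matrix (suc n)
  M x y = kronecker (ρ x) (σ y)
  term≥0 : ∀ j → NonNegRep (laplaceTerm n M j)
  term≥0 zero    = nonNegRep-* nonNegRep-1P (nonNegRep-* (nonNegRep-kronecker (ρ zero) (σ zero))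
                     (kronecker-TP n (ρ ∘ suc) (σ ∘ suc) (strictlyIncreasing-tail ρ↑) (strictlyIncreasing-tail σ↑)))
  term≥0 (suc j) with ρ zero ℕP.≟ σ (suc j)
  ... | no ρ₀≢σⱼ = nonNegRep-≈0P (begin
    s * (M zero (suc j) * D′) ≡⟨ cong (λ e → s * (e * D′)) (kronecker-≢ ρ₀≢σⱼ) ⟩
    s * (0P * D′)             ≈⟨ *-congˡ s (R.zeroˡ D′) ⟩
    s * 0P                    ≈⟨ R.zeroʳ s ⟩
    0P                        ∎)
    where
    s = sign (toℕ (suc j))
    D′ = det n (minor (suc j) M)
  ... | yes ρ₀≡σⱼ = nonNegRep-≈0P (begin
    s * (M zero (suc j) * det n (minor (suc j) M)) ≈⟨ *-congˡ s (*-congˡ (M zero (suc j)) minor≈0) ⟩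
    s * (M zero (suc j) * 0P)                      ≈⟨ *-congˡ s (R.zeroʳ (M zero (suc j))) ⟩
    s * 0P                                         ≈⟨ R.zeroʳ s ⟩
    0P                                             ∎)
    where
    s = sign (toℕ (suc j))
    -- σ₀ < σⱼ₊₁ = ρ₀ < ρₓ₊₁, so column σ₀ meets no row of this minor.
    below-ρ : ∀ x → σ zero ℕ.< ρ (suc x)
    below-ρ x = ℕP.<-trans (σ↑ zero (suc j) (s≤s z≤n))
                           (subst (ℕ._< ρ (suc x)) ρ₀≡σⱼ (ρ↑ zero (suc x) (s≤s z≤n)))
    first = punchOut {i = suc j} {j = zero} (λ ())
    minor≈0 : det n (minor (suc j) M) ≈ 0P
    minor≈0 = det-zero-column n (minor (suc j) M) first λ x →
      R.reflexive (trans (cong (kronecker (ρ (suc x)) ∘ σ) (FinP.punchIn-punchOut _)) (kronecker-≢ (ℕP.>⇒≢ (below-ρ x))))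

-- Right multiplication by a bidiagonal matrix with entries A k, B k: expand the combined columns
-- one at a time by linearity; every minor of G that arises has weakly increasing columns (this
-- is the invariant Separated), so it either repeats a column and vanishes, or is a minor of G.
module _ {G : ℕ → ℕ → Poly} {A B : ℕ → Poly} (G-TP : TotallyPositive G)
         (A≥0 : ∀ k → NonNegRep (A k)) (B≥0 : ∀ k → NonNegRep (B k))
         {n : ℕ} (ρ : Fin n → ℕ) (ρ↑ : StrictlyIncreasing ρ) where

  combined : ℕ → ℕ → Poly
  combined j k = A k * G j k + B k * G j (suc k)

  mixed : (Fin n → ℕ) → (Fin n → Bool) → Matrix n
  mixed τ mix x y = if mix y then combined (ρ x) (τ y) else G (ρ x) (τ y)

  -- The largest column of G that column y of `mixed τ mix` involves.
  reach : (Fin n → ℕ) → (Fin n → Bool) → Fin n → ℕ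
  reach τ mix y = if mix y then suc (τ y) else τ y

  Separated : (Fin n → ℕ) → (Fin n → Bool) → Set
  Separated τ mix = ∀ y₁ y₂ → y₁ Fin.< y₂ → reach τ mix y₁ ℕ.≤ τ y₂

  MixedBelow : ℕ → (Fin n → Bool) → Set
  MixedBelow t mix = ∀ y → t ℕ.≤ toℕ y → mix y ≡ false

  NonNegRepWhenMixedBelow : ℕ → Set
  NonNegRepWhenMixedBelow t = ∀ τ mix → Separated τ mix → MixedBelow t mix → NonNegRep (det n (mixed τ mix))

  τ≤reach : ∀ τ mix y → τ y ℕ.≤ reach τ mix y
  τ≤reach τ mix y with mix y
  ... | true  = ℕP.n≤1+n (τ y)
  ... | false = ℕP.≤-refl

  reach-mono : ∀ {τ τ′} mix → (∀ y → τ y ℕ.≤ τ′ y) → ∀ y → reach τ mix y ℕ.≤ reach τ′ mix y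
  reach-mono mix τ≤τ′ y with mix y
  ... | true  = s≤s (τ≤τ′ y)
  ... | false = τ≤τ′ y

  separated⇒monotone : ∀ {τ mix} → Separated τ mix → Monotone τ
  separated⇒monotone {τ} {mix} sep = monotone-from-< λ x y x<y → ℕP.≤-trans (τ≤reach τ mix x) (sep x y x<y)

  mixedBelow-step : ∀ {t mix y₀} → toℕ y₀ ≡ t → mix y₀ ≡ false → MixedBelow (suc t) mix → MixedBelow t mix
  mixedBelow-step {mix = mix} y₀≡t mix-y₀ below y t≤y with toℕ y ℕP.≟ _
  ... | yes y≡t = subst (λ z → mix z ≡ false) (FinP.toℕ-injective (trans y₀≡t (sym y≡t))) mix-y₀
  ... | no  y≢t = below y (ℕP.≤∧≢⇒< t≤y (y≢t ∘ sym))

  pure-columns : ∀ {τ mix} → MixedBelow 0 mix → ∀ x y → mixed τ mix x y ≈ G (ρ x) (τ y)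
  pure-columns pure x y rewrite pure y z≤n = R.refl

  pure-nonNegRep : NonNegRepWhenMixedBelow 0
  pure-nonNegRep τ mix sep pure with FinP.any? (λ y₁ → FinP.any? (λ y₂ → y₁ FinP.<? y₂ ×-dec τ y₁ ℕP.≟ τ y₂))
  ... | yes (y₁ , y₂ , y₁<y₂ , τy₁≡τy₂) = nonNegRep-≈0P (R.trans (det-cong n (pure-columns pure))
          (det-repeated-column n (G ∘ ρ) (separated⇒monotone sep) y₁<y₂ τy₁≡τy₂))
  ... | no no-repeat = nonNegRep-resp (R.sym (det-cong n (pure-columns pure))) (G-TP n ρ τ ρ↑ τ↑)
    where
    τ↑ : StrictlyIncreasing τ
    τ↑ y₁ y₂ y₁<y₂ = ℕP.≤∧≢⇒< (separated⇒monotone sep y₁ y₂ (ℕP.<⇒≤ y₁<y₂))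
                               λ τy₁≡τy₂ → no-repeat (y₁ , y₂ , y₁<y₂ , τy₁≡τy₂)

  module Split (τ : Fin n → ℕ) (mix : Fin n → Bool) (y₀ : Fin n) (mix-y₀ : mix y₀ ≡ true) where

    mix₀ : Fin n → Bool
    mix₀ = updateAt mix y₀ (λ _ → false)

    τ₊ : Fin n → ℕ
    τ₊ = updateAt τ y₀ suc

    det-split : det n (mixed τ mix) ≈ A (τ y₀) * det n (mixed τ mix₀) + B (τ y₀) * det n (mixed τ₊ mix₀)
    det-split = det-linear n split
      where
      off-y₀ : ∀ x c → c ≢ y₀ → mixed τ mix x c ≈ mixed τ mix₀ x c
      off-y₀ x c c≢y₀ rewrite updateAt-minimal c y₀ {λ _ → false} mix c≢y₀ = R.refl
      off-y₀₊ : ∀ x c → c ≢ y₀ → mixed τ mix x c ≈ mixed τ₊ mix₀ x c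
      off-y₀₊ x c c≢y₀
        rewrite updateAt-minimal c y₀ {λ _ → false} mix c≢y₀ | updateAt-minimal c y₀ {suc} τ c≢y₀ = R.refl
      at-y₀ : ∀ x → mixed τ mix x y₀ ≈ A (τ y₀) * mixed τ mix₀ x y₀ + B (τ y₀) * mixed τ₊ mix₀ x y₀
      at-y₀ x rewrite mix-y₀ | updateAt-updates y₀ {λ _ → false} mix | updateAt-updates y₀ {suc} τ = R.refl
      split : SplitsAt y₀ (A (τ y₀)) (B (τ y₀)) (mixed τ mix) (mixed τ mix₀) (mixed τ₊ mix₀)
      split = record { off₁ = off-y₀ ; off₂ = off-y₀₊ ; at-y = at-y₀ }

    τ≤τ₊ : ∀ y → τ y ℕ.≤ τ₊ y
    τ≤τ₊ y with y Fin.≟ y₀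
    ... | yes refl = subst (τ y₀ ℕ.≤_) (sym (updateAt-updates y₀ {suc} τ)) (ℕP.n≤1+n (τ y₀))
    ... | no y≢y₀  = ℕP.≤-reflexive (sym (updateAt-minimal y y₀ {suc} τ y≢y₀))

    reach-τ₊ : ∀ y → reach τ₊ mix₀ y ≡ reach τ mix y
    reach-τ₊ y with y Fin.≟ y₀
    ... | yes refl rewrite mix-y₀ | updateAt-updates y₀ {λ _ → false} mix | updateAt-updates y₀ {suc} τ = refl
    ... | no y≢y₀  rewrite updateAt-minimal y y₀ {λ _ → false} mix y≢y₀ | updateAt-minimal y y₀ {suc} τ y≢y₀ = refl

    separated₀ : Separated τ mix → Separated τ mix₀
    separated₀ sep y₁ y₂ y₁<y₂ =
      ℕP.≤-trans (reach-mono mix₀ τ≤τ₊ y₁) (subst (ℕ._≤ τ y₂) (sym (reach-τ₊ y₁)) (sep y₁ y₂ y₁<y₂))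

    separated₊ : Separated τ mix → Separated τ₊ mix₀
    separated₊ sep y₁ y₂ y₁<y₂ =
      subst (ℕ._≤ τ₊ y₂) (sym (reach-τ₊ y₁)) (ℕP.≤-trans (sep y₁ y₂ y₁<y₂) (τ≤τ₊ y₂))

    mix₀-off : ∀ y → mix y ≡ false → mix₀ y ≡ false
    mix₀-off y mix-y with y Fin.≟ y₀
    ... | yes refl = updateAt-updates y₀ {λ _ → false} mix
    ... | no y≢y₀  = trans (updateAt-minimal y y₀ {λ _ → false} mix y≢y₀) mix-y

    mixedBelow₀ : ∀ {t} → toℕ y₀ ≡ t → MixedBelow (suc t) mix → MixedBelow t mix₀
    mixedBelow₀ y₀≡t below =
      mixedBelow-step y₀≡t (updateAt-updates y₀ {λ _ → false} mix) λ y t<y → mix₀-off y (below y t<y)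

  expand-column : ∀ t → NonNegRepWhenMixedBelow t → NonNegRepWhenMixedBelow (suc t)
  expand-column t ih τ mix sep below with t ℕP.<? n
  ... | no t≮n  = ih τ mix sep λ y t≤y → ⊥-elim (t≮n (ℕP.≤-<-trans t≤y (FinP.toℕ<n y)))
  ... | yes t<n = expand-at (fromℕ< t<n) (FinP.toℕ-fromℕ< t<n)
    where
    expand-at : ∀ y₀ → toℕ y₀ ≡ t → NonNegRep (det n (mixed τ mix))
    expand-at y₀ y₀≡t with mix y₀ in mix-y₀
    ... | false = ih τ mix sep (mixedBelow-step y₀≡t mix-y₀ below)
    ... | true  = nonNegRep-resp (R.sym det-split)
      (nonNegRep-+ (nonNegRep-* (A≥0 (τ y₀)) (ih τ mix₀ (separated₀ sep) (mixedBelow₀ y₀≡t below)))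
                  (nonNegRep-* (B≥0 (τ y₀)) (ih τ₊ mix₀ (separated₊ sep) (mixedBelow₀ y₀≡t below))))
      where open Split τ mix y₀ mix-y₀

  all-nonNegRep : ∀ t → NonNegRepWhenMixedBelow t
  all-nonNegRep zero    = pure-nonNegRep
  all-nonNegRep (suc t) = expand-column t (all-nonNegRep t)

  combined-nonNegRep : ∀ σ → StrictlyIncreasing σ → NonNegRep (det n (λ x y → combined (ρ x) (σ y)))
  combined-nonNegRep σ σ↑ = all-nonNegRep n σ (λ _ → true) σ↑ λ y n≤y → ⊥-elim (ℕP.<⇒≱ (FinP.toℕ<n y) n≤y)

bidiagonal-TP : ∀ {G A B} → TotallyPositive G → (∀ k → NonNegRep (A k)) → (∀ k → NonNegRep (B k)) →
                TotallyPositive (λ j k → A k * G j k + B k * G j (suc k))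
bidiagonal-TP {G} {A} {B} G-TP A≥0 B≥0 n ρ σ ρ↑ σ↑ = combined-nonNegRep {G} {A} {B} G-TP A≥0 B≥0 ρ ρ↑ σ σ↑

-- Path sums of the network

sumP-map-cong : ∀ (l : List X) {f g : X → Poly} → (∀ x → f x ≈ g x) → sumP (map f l) ≈ sumP (map g l)
sumP-map-cong []      f≈g = R.refl
sumP-map-cong (x ∷ l) f≈g = R.+-cong (f≈g x) (sumP-map-cong l f≈g)

sumP-map-*ˡ : ∀ (l : List X) w (f : X → Poly) → sumP (map (λ x → w * f x) l) ≈ w * sumP (map f l)
sumP-map-*ˡ []      w f = R.sym (R.zeroʳ w)
sumP-map-*ˡ (x ∷ l) w f = R.trans (R.+-congˡ (sumP-map-*ˡ l w f)) (R.sym (R.distribˡ w (f x) (sumP (map f l))))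

weightH : ℕ → ℕ → Poly
weightH i j = toPoly (edgeW H i j)

weightD : ℕ → ℕ → Poly
weightD i j = toPoly (edgeW D i j)

-- pathSum d i j k is the total weight of the d-step paths from (i, j) that end in column k.
pathSum : ℕ → ℕ → ℕ → ℕ → Poly
pathSum zero    i j k = kronecker j k
pathSum (suc d) i j k = weightH i j * pathSum d (pred i) j k + weightD i j * pathSum d (pred i) (j ∸ 1) k

endingAt : ℕ → Maybe (ℕ × Poly) → Poly
endingAt k nothing         = 0P
endingAt k (just (j , p)) = if j ≡ᵇ k then p else 0P

contrib-endingAt : ∀ n k ss → contrib n k ss ≡ endingAt (Δ k) (run (Δ n) (Δ n) ss)
contrib-endingAt n k ss with run (Δ n) (Δ n) ss
... | nothing = refl
... | just _  = refl

if-scale : ∀ w p b → (if b then w * p else 0P) ≈ w * (if b then p else 0P)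
if-scale w p true  = R.refl
if-scale w p false = R.sym (R.zeroʳ w)

endingAt-step : ∀ i j k s ss →
  endingAt k (run (suc i) j (s ∷ ss)) ≈ toPoly (edgeW s (suc i) j) * endingAt k (run i (target s j) ss)
endingAt-step i j k s ss with edgeW s (suc i) j
... | wzero = R.refl
... | wone with run i (target s j) ss
...   | nothing       = R.refl
...   | just (j′ , p) = if-scale 1P p (j′ ≡ᵇ k)
endingAt-step i j k s ss | wvar v with run i (target s j) ss
...   | nothing       = R.refl
...   | just (j′ , p) = if-scale (varP v) p (j′ ≡ᵇ k)

pathSum-seqs : ∀ i j k → sumP (map (endingAt k ∘ run i j) (seqs i)) ≈ pathSum i i j k
pathSum-seqs zero    j k = R.+-identityʳ (kronecker j k)
pathSum-seqs (suc i) j k = begin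
  sumP (map f (map (H ∷_) S ++ map (D ∷_) S))
    ≡⟨ cong sumP (List.map-++ f (map (H ∷_) S) (map (D ∷_) S)) ⟩
  sumP (map f (map (H ∷_) S) ++ map f (map (D ∷_) S))
    ≡⟨ List.concat-++ (map f (map (H ∷_) S)) (map f (map (D ∷_) S)) ⟨
  sumP (map f (map (H ∷_) S)) + sumP (map f (map (D ∷_) S))
    ≈⟨ R.+-cong (first-step H) (first-step D) ⟩
  weightH (suc i) j * pathSum i i j k + weightD (suc i) j * pathSum i i (j ∸ 1) k
    ∎
  where
  S = seqs i
  f = endingAt k ∘ run (suc i) j
  first-step : ∀ s → sumP (map f (map (s ∷_) S)) ≈ toPoly (edgeW s (suc i) j) * pathSum i i (target s j) k
  first-step s = begin
    sumP (map f (map (s ∷_) S))                                   ≡⟨ cong sumP (List.map-∘ S) ⟨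
    sumP (map (f ∘ (s ∷_)) S)                                     ≈⟨ sumP-map-cong S (endingAt-step i j k s) ⟩
    sumP (map (λ ss → w * endingAt k (run i (target s j) ss)) S) ≈⟨ sumP-map-*ˡ S w (endingAt k ∘ run i (target s j)) ⟩
    w * sumP (map (endingAt k ∘ run i (target s j)) S)            ≈⟨ *-congˡ w (pathSum-seqs i (target s j) k) ⟩
    w * pathSum i i (target s j) k                                 ∎
    where w = toPoly (edgeW s (suc i) j)

T≈pathSum : ∀ n k → T n k ≈ pathSum (Δ n) (Δ n) (Δ n) (Δ k)
T≈pathSum n k = R.trans (R.reflexive (cong sumP (List.map-cong (contrib-endingAt n k) (seqs (Δ n)))))
                        (pathSum-seqs (Δ n) (Δ n) (Δ k))

pathSum-vanish : ∀ d i j k → k ℕ.< i ∸ d → i ℕ.≤ j → pathSum d i j k ≈ 0P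
pathSum-vanish zero    i       j k k<i i≤j =
  R.reflexive (kronecker-≢ λ j≡k → ℕP.<-irrefl (sym j≡k) (ℕP.<-≤-trans k<i i≤j))
pathSum-vanish (suc d) (suc i) j k k<i i≤j = begin
  wH * pathSum d i j k + wD * pathSum d i (j ∸ 1) k
    ≈⟨ R.+-cong (*-congˡ wH (pathSum-vanish d i j k k<i (ℕP.≤-trans (ℕP.n≤1+n i) i≤j)))
                (*-congˡ wD (pathSum-vanish d i (j ∸ 1) k k<i (ℕP.∸-monoˡ-≤ 1 i≤j))) ⟩
  wH * 0P + wD * 0P
    ≈⟨ R.+-cong (R.zeroʳ wH) (R.zeroʳ wD) ⟩
  0P + 0P
    ≈⟨ R.+-identityˡ 0P ⟩
  0P
    ∎
  where
  wH = weightH (suc i) j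
  wD = weightD (suc i) j

kronecker-swap : ∀ (f : ℕ → Poly) j k → f j * kronecker j k ≈ kronecker j k * f k
kronecker-swap f j k with j ℕP.≟ k
... | yes refl = R.*-comm (f j) (kronecker j j)
... | no  j≢k  rewrite kronecker-≢ j≢k = R.zeroʳ (f j)

pathSum-last-step : ∀ d i j k → suc d ℕ.≤ i → i ℕ.≤ j →
  pathSum (suc d) i j k ≈ pathSum d i j k * weightH (i ∸ d) k + pathSum d i j (suc k) * weightD (i ∸ d) (suc k)
pathSum-last-step zero    (suc i) (suc j) k _ _ =
  R.+-cong (kronecker-swap (weightH (suc i)) (suc j) k) (kronecker-swap (λ z → weightD (suc i) (suc z)) j k)
pathSum-last-step (suc d) (suc i) j k (s≤s d<i) i≤j = begin
  wH * pathSum (suc d) i j k + wD * pathSum (suc d) i (j ∸ 1) k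
    ≈⟨ R.+-cong (*-congˡ wH (pathSum-last-step d i j k d<i (ℕP.≤-trans (ℕP.n≤1+n i) i≤j)))
                (*-congˡ wD (pathSum-last-step d i (j ∸ 1) k d<i (ℕP.∸-monoˡ-≤ 1 i≤j))) ⟩
  wH * (pathSum d i j k * h + pathSum d i j (suc k) * v) + wD * (pathSum d i (j ∸ 1) k * h + pathSum d i (j ∸ 1) (suc k) * v)
    ≈⟨ solve 8 (λ wH wD a b c d h v →
                  wH ⊗ (a ⊗ h ⊕ b ⊗ v) ⊕ wD ⊗ (c ⊗ h ⊕ d ⊗ v) ⊜ ((wH ⊗ a ⊕ wD ⊗ c) ⊗ h ⊕ (wH ⊗ b ⊕ wD ⊗ d) ⊗ v))
             R.refl wH wD (pathSum d i j k) (pathSum d i j (suc k)) (pathSum d i (j ∸ 1) k) (pathSum d i (j ∸ 1) (suc k)) h v ⟩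
  pathSum (suc d) (suc i) j k * h + pathSum (suc d) (suc i) j (suc k) * v
    ∎
  where
  wH = weightH (suc i) j
  wD = weightD (suc i) j
  h = weightH (i ∸ d) k
  v = weightD (i ∸ d) (suc k)

-- Layer i of the network as a bidiagonal matrix, padded with the identity on the
-- columns k ≤ i, which paths starting on the diagonal above row i never reach.
layerH : ℕ → ℕ → Poly
layerH i k = if k ≤ᵇ i then 1P else weightH (suc i) k

layerD : ℕ → ℕ → Poly
layerD i k = if k <ᵇ i then 0P else weightD (suc i) (suc k)

layerH-≤ : ∀ {i k} → k ℕ.≤ i → layerH i k ≡ 1P
layerH-≤ {i} {k} k≤i = cong (if_then 1P else weightH (suc i) k) (dec-true (k ℕP.≤? i) k≤i)

layerH-≰ : ∀ {i k} → ¬ k ℕ.≤ i → layerH i k ≡ weightH (suc i) k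
layerH-≰ {i} {k} k≰i = cong (if_then 1P else weightH (suc i) k) (dec-false (k ℕP.≤? i) k≰i)

layerD-< : ∀ {i k} → k ℕ.< i → layerD i k ≡ 0P
layerD-< {i} {k} k<i = cong (if_then 0P else weightD (suc i) (suc k)) (dec-true (k ℕP.<? i) k<i)

layerD-≮ : ∀ {i k} → ¬ k ℕ.< i → layerD i k ≡ weightD (suc i) (suc k)
layerD-≮ {i} {k} k≮i = cong (if_then 0P else weightD (suc i) (suc k)) (dec-false (k ℕP.<? i) k≮i)

nonNegRep-layerH : ∀ i k → NonNegRep (layerH i k)
nonNegRep-layerH i k with k ℕP.≤? i
... | yes k≤i rewrite layerH-≤ k≤i = nonNegRep-1P
... | no  k≰i rewrite layerH-≰ k≰i = nonNegRep-toPoly _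

nonNegRep-layerD : ∀ i k → NonNegRep (layerD i k)
nonNegRep-layerD i k with k ℕP.<? i
... | yes k<i rewrite layerD-< k<i = nonNegRep-0P
... | no  k≮i rewrite layerD-≮ k≮i = nonNegRep-toPoly _

-- fromDiagonal i j k is the total weight of the paths from (j, j) down to (i, k).
fromDiagonal : ℕ → ℕ → ℕ → Poly
fromDiagonal i j k = pathSum (j ∸ i) j j k

layerH-kronecker : ∀ {i j} k → j ℕ.≤ i → layerH i k * kronecker j k ≈ kronecker j k
layerH-kronecker {i} {j} k j≤i with j ℕP.≟ k
... | yes refl rewrite layerH-≤ j≤i = R.*-identityˡ (kronecker j j)
... | no  j≢k  rewrite kronecker-≢ j≢k = R.zeroʳ (layerH i k)

layerD-kronecker : ∀ {i j} k → j ℕ.≤ i → layerD i k * kronecker j (suc k) ≈ 0P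
layerD-kronecker {i} {j} k j≤i with j ℕP.≟ suc k
... | yes refl rewrite layerD-< j≤i = R.zeroˡ (kronecker j j)
... | no  j≢k  rewrite kronecker-≢ j≢k = R.zeroʳ (layerD i k)

-- The padding of layer i only meets columns k ≤ i, which these paths cannot reach.
layerH-pathSum : ∀ {i d j} k → j ∸ d ≡ suc i → layerH i k * pathSum d j j k ≈ pathSum d j j k * weightH (suc i) k
layerH-pathSum {i} {d} {j} k j∸d≡1+i with k ℕP.≤? i
... | no  k≰i rewrite layerH-≰ k≰i = R.*-comm (weightH (suc i) k) (pathSum d j j k)
... | yes k≤i rewrite layerH-≤ k≤i = begin
  1P * pathSum d j j k                   ≈⟨ R.*-identityˡ (pathSum d j j k) ⟩
  pathSum d j j k                        ≈⟨ vanishes ⟩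
  0P                                     ≈⟨ R.zeroˡ (weightH (suc i) k) ⟨
  0P * weightH (suc i) k                 ≈⟨ *-congʳ (weightH (suc i) k) vanishes ⟨
  pathSum d j j k * weightH (suc i) k    ∎
  where
  vanishes = pathSum-vanish d j j k (subst (k ℕ.<_) (sym j∸d≡1+i) (s≤s k≤i)) ℕP.≤-refl

layerD-pathSum : ∀ {i d j} k → j ∸ d ≡ suc i →
                 layerD i k * pathSum d j j (suc k) ≈ pathSum d j j (suc k) * weightD (suc i) (suc k)
layerD-pathSum {i} {d} {j} k j∸d≡1+i with k ℕP.<? i
... | no  k≮i rewrite layerD-≮ k≮i = R.*-comm (weightD (suc i) (suc k)) (pathSum d j j (suc k))
... | yes k<i rewrite layerD-< k<i = begin
  0P * pathSum d j j (suc k)                   ≈⟨ R.zeroˡ (pathSum d j j (suc k)) ⟩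
  0P                                           ≈⟨ R.zeroˡ (weightD (suc i) (suc k)) ⟨
  0P * weightD (suc i) (suc k)                 ≈⟨ *-congʳ (weightD (suc i) (suc k)) vanishes ⟨
  pathSum d j j (suc k) * weightD (suc i) (suc k) ∎
  where
  vanishes = pathSum-vanish d j j (suc k) (subst (suc k ℕ.<_) (sym j∸d≡1+i) (s≤s k<i)) ℕP.≤-refl

fromDiagonal-step : ∀ i j k →
  fromDiagonal i j k ≈ layerH i k * fromDiagonal (suc i) j k + layerD i k * fromDiagonal (suc i) j (suc k)
fromDiagonal-step i j k with j ℕP.≤? i
... | yes j≤i rewrite ℕP.m≤n⇒m∸n≡0 j≤i | ℕP.m≤n⇒m∸n≡0 (ℕP.m≤n⇒m≤1+n j≤i) = R.sym (begin
  layerH i k * kronecker j k + layerD i k * kronecker j (suc k) ≈⟨ R.+-cong (layerH-kronecker k j≤i) (layerD-kronecker k j≤i) ⟩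
  kronecker j k + 0P                                            ≈⟨ R.+-identityʳ (kronecker j k) ⟩
  kronecker j k                                                 ∎)
... | no j≰i = begin
  pathSum (j ∸ i) j j k
    ≡⟨ cong (λ e → pathSum e j j k) j∸i≡1+d ⟩
  pathSum (suc d) j j k
    ≈⟨ pathSum-last-step d j j k (subst (ℕ._≤ j) j∸i≡1+d (ℕP.m∸n≤m j i)) ℕP.≤-refl ⟩
  pathSum d j j k * weightH (j ∸ d) k + pathSum d j j (suc k) * weightD (j ∸ d) (suc k)
    ≡⟨ cong (λ e → pathSum d j j k * weightH e k + pathSum d j j (suc k) * weightD e (suc k)) j∸d≡1+i ⟩
  pathSum d j j k * weightH (suc i) k + pathSum d j j (suc k) * weightD (suc i) (suc k)
    ≈⟨ R.+-cong (layerH-pathSum {i} {d} {j} k j∸d≡1+i) (layerD-pathSum {i} {d} {j} k j∸d≡1+i) ⟨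
  layerH i k * pathSum d j j k + layerD i k * pathSum d j j (suc k)
    ∎
  where
  i<j = ℕP.≰⇒> j≰i
  d = j ∸ suc i
  j∸i≡1+d : j ∸ i ≡ suc d
  j∸i≡1+d = ℕP.+-∸-assoc 1 i<j
  j∸d≡1+i : j ∸ d ≡ suc i
  j∸d≡1+i = ℕP.m∸[m∸n]≡n i<j

layers : ℕ → ℕ → ℕ → ℕ → Poly
layers i zero    j k = kronecker j k
layers i (suc h) j k = layerH i k * layers (suc i) h j k + layerD i k * layers (suc i) h j (suc k)

layers-TP : ∀ h i → TotallyPositive (layers i h)
layers-TP zero    i = kronecker-TP
layers-TP (suc h) i = bidiagonal-TP {layers (suc i) h} (layers-TP h (suc i)) (nonNegRep-layerH i) (nonNegRep-layerD i)

layers≈fromDiagonal : ∀ h i j k → j ℕ.≤ i ℕ.+ h → layers i h j k ≈ fromDiagonal i j k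
layers≈fromDiagonal zero    i j k j≤i+0 =
  R.reflexive (cong (λ e → pathSum e j j k) (sym (ℕP.m≤n⇒m∸n≡0 (subst (j ℕ.≤_) (ℕP.+-identityʳ i) j≤i+0))))
layers≈fromDiagonal (suc h) i j k j≤i+1+h = R.trans
  (R.+-cong (*-congˡ (layerH i k) (layers≈fromDiagonal h (suc i) j k j≤1+i+h))
            (*-congˡ (layerD i k) (layers≈fromDiagonal h (suc i) j (suc k) j≤1+i+h)))
  (R.sym (fromDiagonal-step i j k))
  where
  j≤1+i+h = subst (j ℕ.≤_) (ℕP.+-suc i h) j≤i+1+h

Δ-mono-≤ : ∀ {m n} → m ℕ.≤ n → Δ m ℕ.≤ Δ n
Δ-mono-≤ {zero}          _         = z≤n
Δ-mono-≤ {suc m} {suc n} (s≤s m≤n) = ℕP.+-mono-≤ (s≤s m≤n) (Δ-mono-≤ m≤n)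

Δ-mono-< : ∀ {m n} → m ℕ.< n → Δ m ℕ.< Δ n
Δ-mono-< {m} m<n = ℕP.<-≤-trans (s≤s (ℕP.m≤n+m (Δ m) m)) (Δ-mono-≤ m<n)

strictlyIncreasing-Δ : ∀ {f : Fin n → ℕ} → StrictlyIncreasing f → StrictlyIncreasing (Δ ∘ f)
strictlyIncreasing-Δ f↑ x y x<y = Δ-mono-< (f↑ x y x<y)

proposition3p1 : CoeffTP T
proposition3p1 zero    _ _ _  _  = nonNegRep⇒nonNeg nonNegRep-1P
proposition3p1 (suc m) r c r↑ c↑ = nonNegRep⇒nonNeg
  (nonNegRep-resp (det-cong (suc m) entries)
    (layers-TP h 0 (suc m) (Δ ∘ r) (Δ ∘ c) (strictlyIncreasing-Δ r↑) (strictlyIncreasing-Δ c↑)))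
  where
  h = Δ (r (Fin.fromℕ m))
  row≤h : ∀ x → Δ (r x) ℕ.≤ h
  row≤h x = Δ-mono-≤ (strictlyIncreasing⇒monotone r↑ x (Fin.fromℕ m) (FinP.≤fromℕ x))
  entries : ∀ x y → layers 0 h (Δ (r x)) (Δ (c y)) ≈ T (r x) (c y)
  entries x y = R.trans (layers≈fromDiagonal h 0 (Δ (r x)) (Δ (c y)) (row≤h x)) (R.sym (T≈pathSum (r x) (c y)))
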